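{- Let $q$ be a prime power, $V$ an $n$-dimensional vector space over $\mathbb{F}_q$, and $k,t,r$ positive integers with $r\geq 2$. If $r>k-t+1$, then there is no non-trivial $r$-wise $t$-intersecting family of $k$-subspaces of $V$.
   Context: A family $\mathcal{F}$ of $k$-subspaces of $V$ is $r$-wise $t$-intersecting if $\dim(F_1\cap\cdots\cap F_r)\geq t$ for all (not necessarily distinct) $F_1,\ldots,F_r\in\mathcal{F}$; it is trivial if all its members contain a common $t$-subspace, and non-trivial otherwise. -}

module Defs where

open import Level using (Level; _⊔_) renaming (suc to lsuc)
open import Data.Nat using (ℕ; suc; _^_)
open import Data.Nat.Primality using (Prime)
open import Data.Fin using (Fin)
open import Data.Product using (Σ; ∃; ∃-syntax; _×_; _,_)
open import Relation.Nullary using (¬_)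
open import Relation.Binary.PropositionalEquality using (_≡_)
open import Algebra.Bundles using (CommutativeRing)

IsPrimePower : ℕ → Set
IsPrimePower q = ∃[ p ] ∃[ e ] (Prime p × q ≡ p ^ suc e)

record Field c ℓ : Set (lsuc (c ⊔ ℓ)) where
  field
    commutativeRing : CommutativeRing c ℓ
  open CommutativeRing commutativeRing public
  field
    0≉1     : ¬ (0# ≈ 1#)
    inverse : ∀ x → ¬ (x ≈ 0#) → ∃[ y ] (x * y ≈ 1#)

HasSize : ∀ {c ℓ} → Field c ℓ → ℕ → Set (c ⊔ ℓ)
HasSize F q = Σ (Fin q → Carrier) λ e →
    (∀ i j → e i ≈ e j → i ≡ j) × (∀ x → ∃[ i ] (e i ≈ x))
  where open Field F

module LinearAlgebra {c ℓ} (F : Field c ℓ) (n : ℕ) where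
  open Field F

  V : Set c
  V = Fin n → Carrier

  _≈ᵥ_ : V → V → Set ℓ
  u ≈ᵥ v = ∀ i → u i ≈ v i

  0ᵥ : V
  0ᵥ _ = 0#

  _+ᵥ_ : V → V → V
  (u +ᵥ v) i = u i + v i

  _·_ : Carrier → V → V
  (a · v) i = a * v i

  lincomb : ∀ {m} → (Fin m → Carrier) → (Fin m → V) → V
  lincomb {ℕ.zero}  cs vs = 0ᵥ
  lincomb {suc m} cs vs = (cs Fin.zero · vs Fin.zero)
                          +ᵥ lincomb (λ i → cs (Fin.suc i)) (λ i → vs (Fin.suc i))

  LinIndep : ∀ {m} → (Fin m → V) → Set (c ⊔ ℓ)
  LinIndep {m} vs = ∀ (cs : Fin m → Carrier) → lincomb cs vs ≈ᵥ 0ᵥ → ∀ i → cs i ≈ 0#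

  record Subspace (d : ℕ) : Set (c ⊔ ℓ) where
    constructor subspace
    field
      basis : Fin d → V
      indep : LinIndep basis

  _∈ₛ_ : ∀ {d} → V → Subspace d → Set (c ⊔ ℓ)
  v ∈ₛ W = ∃[ cs ] (lincomb cs (Subspace.basis W) ≈ᵥ v)

  _⊆ₛ_ : ∀ {d e} → Subspace d → Subspace e → Set (c ⊔ ℓ)
  U ⊆ₛ W = ∀ v → v ∈ₛ U → v ∈ₛ W

  -- dim (W₁ ∩ ⋯ ∩ W_r) ≥ t : the intersection contains t linearly independent vectors
  DimInterGE : ∀ {d r} → (Fin r → Subspace d) → ℕ → Set (c ⊔ ℓ)
  DimInterGE {d} {r} Ws t =
    ∃[ us ] (LinIndep {t} us × (∀ j i → us j ∈ₛ Ws i))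

  -- A family of k-subspaces: a predicate on k-subspaces, required to respect
  -- equality of subspaces (same span), so that it is a family of subspaces
  -- rather than of bases.
  record Family (k : ℕ) : Set (lsuc (c ⊔ ℓ)) where
    field
      _∈F_    : Subspace k → Set (c ⊔ ℓ)
      respect : ∀ {U W} → U ⊆ₛ W → W ⊆ₛ U → _∈F_ U → _∈F_ W
  open Family public

  -- r-wise t-intersecting: any r (not necessarily distinct) members meet in dimension ≥ t
  RWiseTIntersecting : ∀ {k} → ℕ → ℕ → Family k → Set (c ⊔ ℓ)
  RWiseTIntersecting {k} r t 𝓕 =
    ∀ (Ws : Fin r → Subspace k) → (∀ i → _∈F_ 𝓕 (Ws i)) → DimInterGE Ws t

  Trivial : ∀ {k} → ℕ → Family k → Set (c ⊔ ℓ)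
  Trivial {k} t 𝓕 = ∃[ T ] (∀ (W : Subspace k) → _∈F_ 𝓕 W → _⊆ₛ_ {t} T W)

  NonTrivial : ∀ {k} → ℕ → Family k → Set (c ⊔ ℓ)
  NonTrivial t 𝓕 = ¬ Trivial t 𝓕

{-# OPTIONS --safe #-}
-- Suppose r ≥ k − t + 2 and 𝓕 is r-wise t-intersecting and non-trivial.  Any
-- s ≤ r − d members meet in dimension ≥ t + d: by hypothesis they share a
-- t-space T, and T is not contained in every member, so some W ∈ 𝓕 misses a
-- vector v ∈ T; the s + 1 members W, W₁, …, W_s share t + d − 1 independent
-- vectors, and adding v keeps them independent inside W₁ ∩ ⋯ ∩ W_s.  With
-- s = 1 and d = k − t + 1 a single k-space would contain k + 1 independent
-- vectors.  Over a field with q elements that is impossible by counting: m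
-- independent vectors span q^m vectors.
--
-- Constructively the vector v is only found under a double negation, which is
-- enough because the goal is ⊥ and membership in a subspace of a finite space
-- is decidable.
module Submission where

open import Defs
open import Level using (Level)
open import Data.Nat using (ℕ; _≤_; _>_; _+_; _∸_)
open import Data.Product using (∃-syntax; _×_)
open import Relation.Nullary using (¬_)

open import Function using (_∘_)
open import Data.Nat using (zero; suc; _<_; _^_; _%_; s≤s; z≤n)
open import Data.Nat.DivMod using (_mod_; m<n⇒m%n≡m)
open import Data.Nat.Properties
  using (^-monoʳ-<; <⇒≱; ≮⇒≥; ≤-trans; m≤m+n; m≤n+m∸n; n<1+n; +-comm; +-suc; module ≤-Reasoning)
open import Data.Fin using (Fin; toℕ; inject≤; combine; finToFun; funToFin)
open import Data.Fin.Properties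
  using (toℕ-injective; toℕ-fromℕ<; toℕ-inject≤; toℕ<n; inject≤-injective; suc-injective;
         funToFin-finToFin; finToFun-funToFin; injective⇒≤; any?; all?)
  renaming (_≟_ to _≟ᶠ_)
open import Data.Vec.Functional using (_∷_)
open import Data.Product using (_,_; proj₁; proj₂; ∃)
open import Data.Empty using (⊥-elim)
open import Relation.Nullary using (Dec)
open import Relation.Nullary.Decidable using (map′; decidable-stable; yes; no)
open import Relation.Binary.Definitions using (Decidable)
open import Relation.Binary.PropositionalEquality as ≡ using (_≡_; _≢_; _≗_)
import Algebra.Properties.Group as GroupProperties
import Algebra.Properties.Ring as RingProperties
import Algebra.Properties.CommutativeSemigroup as CommutativeSemigroupProperties

m<m∸n+1+n : ∀ m n → m < m ∸ n + 1 + n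
m<m∸n+1+n m n = begin-strict
  m                ≤⟨ m≤n+m∸n m n ⟩
  n + (m ∸ n)      ≡⟨ +-comm n (m ∸ n) ⟩
  m ∸ n + n        <⟨ n<1+n _ ⟩
  suc (m ∸ n) + n  ≡⟨ ≡.cong (_+ n) (+-comm 1 (m ∸ n)) ⟩
  m ∸ n + 1 + n    ∎
  where open ≤-Reasoning

distinct⇒1< : ∀ {n} {i j : Fin n} → i ≢ j → 1 < n
distinct⇒1< {suc zero}    {Fin.zero} {Fin.zero} i≢j = ⊥-elim (i≢j ≡.refl)
distinct⇒1< {suc (suc _)} _                         = s≤s (s≤s z≤n)

mod-inject≤ : ∀ {s r} (i : Fin (suc s)) .(s<r : suc s ≤ r) → toℕ (inject≤ i s<r) mod suc s ≡ i
mod-inject≤ {s} i s<r = toℕ-injective (begin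
  toℕ (toℕ (inject≤ i s<r) mod suc s)  ≡⟨ toℕ-fromℕ< _ ⟩
  toℕ (inject≤ i s<r) % suc s ≡⟨ ≡.cong (_% suc s) (toℕ-inject≤ i s<r) ⟩
  toℕ i % suc s               ≡⟨ m<n⇒m%n≡m (toℕ<n i) ⟩
  toℕ i                                ∎)
  where open ≡.≡-Reasoning

funToFin-cong : ∀ {m q} {f g : Fin m → Fin q} → f ≗ g → funToFin f ≡ funToFin g
funToFin-cong {zero}  _   = ≡.refl
funToFin-cong {suc m} f≗g = ≡.cong₂ combine (f≗g Fin.zero) (funToFin-cong (f≗g ∘ Fin.suc))

finToFun-injective : ∀ {m q} {x y : Fin (q ^ m)} → finToFun {q} {m} x ≗ finToFun y → x ≡ y
finToFun-injective {m} {q} {x} {y} eq =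
  ≡.trans (≡.sym (funToFin-finToFin {m} {q} x))
          (≡.trans (funToFin-cong eq) (funToFin-finToFin {m} {q} y))

injection⇒exponent-≤ : ∀ {m d q} → 1 < q → (Φ : (Fin m → Fin q) → (Fin d → Fin q)) →
                       (∀ a b → Φ a ≗ Φ b → a ≗ b) → m ≤ d
injection⇒exponent-≤ {m} {d} {q} 1<q Φ Φ-injective =
  ≮⇒≥ λ d<m → <⇒≱ (^-monoʳ-< q 1<q d<m) (injective⇒≤ encode-injective)
  where
    encode : Fin (q ^ m) → Fin (q ^ d)
    encode = funToFin ∘ Φ ∘ finToFun

    encode-injective : ∀ {x y} → encode x ≡ encode y → x ≡ y
    encode-injective eq = finToFun-injective (Φ-injective _ _ λ i →
      ≡.trans (≡.sym (finToFun-funToFin _ i))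
              (≡.trans (≡.cong (λ z → finToFun z i) eq) (finToFun-funToFin _ i)))

module Subspaces {c ℓ} (F : Field c ℓ) (n : ℕ) where
  open Field F renaming (_+_ to _⊕_; refl to ≈-refl)
  open LinearAlgebra F n
  open GroupProperties +-group using (x∙y⁻¹≈ε⇒x≈y; inverseʳ-unique; ⁻¹-involutive)
  open RingProperties ring using (-1*x≈-x; -‿distribˡ-*; -‿distribʳ-*)
  open CommutativeSemigroupProperties +-commutativeSemigroup using (interchange)
  open import Relation.Binary.Reasoning.Setoid setoid

  lincomb-cong : ∀ {m} {cs ds : Fin m → Carrier} (vs : Fin m → V) →
                 (∀ j → cs j ≈ ds j) → lincomb cs vs ≈ᵥ lincomb ds vs
  lincomb-cong {zero}  vs _      i = ≈-refl
  lincomb-cong {suc m} vs cs≈ds i =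
    +-cong (*-cong (cs≈ds Fin.zero) ≈-refl) (lincomb-cong (vs ∘ Fin.suc) (cs≈ds ∘ Fin.suc) i)

  lincomb-zero : ∀ {m} (vs : Fin m → V) → lincomb (λ _ → 0#) vs ≈ᵥ 0ᵥ
  lincomb-zero {zero}  vs i = ≈-refl
  lincomb-zero {suc m} vs i =
    trans (+-cong (zeroˡ _) (lincomb-zero (vs ∘ Fin.suc) i)) (+-identityˡ 0#)

  lincomb-+ : ∀ {m} (cs ds : Fin m → Carrier) (vs : Fin m → V) →
              lincomb (λ j → cs j ⊕ ds j) vs ≈ᵥ (lincomb cs vs +ᵥ lincomb ds vs)
  lincomb-+ {zero}  cs ds vs i = sym (+-identityˡ 0#)
  lincomb-+ {suc m} cs ds vs i =
    trans (+-cong (distribʳ _ _ _) (lincomb-+ (cs ∘ Fin.suc) (ds ∘ Fin.suc) (vs ∘ Fin.suc) i))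
          (interchange _ _ _ _)

  lincomb-* : ∀ {m} (a : Carrier) (cs : Fin m → Carrier) (vs : Fin m → V) →
              lincomb (λ j → a * cs j) vs ≈ᵥ (a · lincomb cs vs)
  lincomb-* {zero}  a cs vs i = sym (zeroʳ a)
  lincomb-* {suc m} a cs vs i =
    trans (+-cong (*-assoc _ _ _) (lincomb-* a (cs ∘ Fin.suc) (vs ∘ Fin.suc) i))
          (sym (distribˡ a _ _))

  lincomb-‿ : ∀ {m} (cs : Fin m → Carrier) (vs : Fin m → V) i →
              lincomb (λ j → - cs j) vs i ≈ - lincomb cs vs i
  lincomb-‿ cs vs i = begin
    lincomb (λ j → - cs j) vs i     ≈⟨ lincomb-cong vs (λ j → sym (-1*x≈-x (cs j))) i ⟩
    lincomb (λ j → - 1# * cs j) vs i ≈⟨ lincomb-* (- 1#) cs vs i ⟩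
    - 1# * lincomb cs vs i           ≈⟨ -1*x≈-x _ ⟩
    - lincomb cs vs i                ∎

  LinIndep-injective : ∀ {m} {vs : Fin m → V} → LinIndep vs → ∀ {cs ds} →
                       lincomb cs vs ≈ᵥ lincomb ds vs → ∀ j → cs j ≈ ds j
  LinIndep-injective {vs = vs} indep {cs} {ds} eq j =
    x∙y⁻¹≈ε⇒x≈y _ _ (indep (λ j → cs j ⊕ - ds j) difference-zero j)
    where
      difference-zero : lincomb (λ j → cs j ⊕ - ds j) vs ≈ᵥ 0ᵥ
      difference-zero i = begin
        lincomb (λ j → cs j ⊕ - ds j) vs i           ≈⟨ lincomb-+ cs (λ j → - ds j) vs i ⟩
        lincomb cs vs i ⊕ lincomb (λ j → - ds j) vs i ≈⟨ +-cong (eq i) (lincomb-‿ ds vs i) ⟩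
        lincomb ds vs i ⊕ - lincomb ds vs i           ≈⟨ -‿inverseʳ _ ⟩
        0#                                            ∎

  module _ {d} (W : Subspace d) where
    open Subspace W using (basis)

    ∈ₛ-resp-≈ᵥ : ∀ {u v} → u ≈ᵥ v → u ∈ₛ W → v ∈ₛ W
    ∈ₛ-resp-≈ᵥ u≈v (cs , p) = cs , λ i → trans (p i) (u≈v i)

    0ᵥ-∈ₛ : 0ᵥ ∈ₛ W
    0ᵥ-∈ₛ = (λ _ → 0#) , lincomb-zero basis

    +ᵥ-∈ₛ : ∀ {u v} → u ∈ₛ W → v ∈ₛ W → (u +ᵥ v) ∈ₛ W
    +ᵥ-∈ₛ (cs , p) (ds , q) =
      (λ j → cs j ⊕ ds j) , λ i → trans (lincomb-+ cs ds basis i) (+-cong (p i) (q i))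

    ·-∈ₛ : ∀ a {v} → v ∈ₛ W → (a · v) ∈ₛ W
    ·-∈ₛ a (cs , p) =
      (λ j → a * cs j) , λ i → trans (lincomb-* a cs basis i) (*-cong ≈-refl (p i))

    lincomb-∈ₛ : ∀ {m} {us : Fin m → V} → (∀ j → us j ∈ₛ W) → ∀ cs → lincomb cs us ∈ₛ W
    lincomb-∈ₛ {zero}  _    cs = 0ᵥ-∈ₛ
    lincomb-∈ₛ {suc m} us∈W cs =
      +ᵥ-∈ₛ (·-∈ₛ (cs Fin.zero) (us∈W Fin.zero)) (lincomb-∈ₛ (us∈W ∘ Fin.suc) (cs ∘ Fin.suc))

    span-⊆ₛ : ∀ {m} {us : Fin m → V} (indep : LinIndep us) →
              (∀ j → us j ∈ₛ W) → subspace us indep ⊆ₛ W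
    span-⊆ₛ _ us∈W v (cs , p) = ∈ₛ-resp-≈ᵥ p (lincomb-∈ₛ us∈W cs)

  c*x+w≈0⇒-y*w≈x : ∀ {c y x w} → c * y ≈ 1# → c * x ⊕ w ≈ 0# → (- y) * w ≈ x
  c*x+w≈0⇒-y*w≈x {c} {y} {x} {w} cy≈1 cx+w≈0 = begin
    (- y) * w          ≈⟨ *-cong ≈-refl (inverseʳ-unique _ _ cx+w≈0) ⟩
    (- y) * - (c * x)  ≈⟨ -‿distribˡ-* y _ ⟨
    - (y * - (c * x))  ≈⟨ -‿cong (-‿distribʳ-* y _) ⟨
    - - (y * (c * x))  ≈⟨ ⁻¹-involutive _ ⟩
    y * (c * x)        ≈⟨ *-assoc y c x ⟨
    (y * c) * x        ≈⟨ *-cong (trans (*-comm y c) cy≈1) ≈-refl ⟩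
    1# * x             ≈⟨ *-identityˡ x ⟩
    x                  ∎

  LinIndep-∷ : Decidable _≈_ → ∀ {m d} (W : Subspace d) {us : Fin m → V} {v} →
               LinIndep us → (∀ j → us j ∈ₛ W) → ¬ (v ∈ₛ W) → LinIndep (v ∷ us)
  LinIndep-∷ _≟_ W {us} {v} indep us∈W v∉W cs eq with cs Fin.zero ≟ 0#
  ... | yes c≈0 = λ { Fin.zero → c≈0 ; (Fin.suc j) → indep (cs ∘ Fin.suc) rest-zero j }
    where
      rest-zero : lincomb (cs ∘ Fin.suc) us ≈ᵥ 0ᵥ
      rest-zero i = begin
        lincomb (cs ∘ Fin.suc) us i                            ≈⟨ +-identityˡ _ ⟨
        0# ⊕ lincomb (cs ∘ Fin.suc) us i                       ≈⟨ +-cong (zeroˡ (v i)) ≈-refl ⟨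
        0# * v i ⊕ lincomb (cs ∘ Fin.suc) us i                 ≈⟨ +-cong (*-cong c≈0 ≈-refl) ≈-refl ⟨
        cs Fin.zero * v i ⊕ lincomb (cs ∘ Fin.suc) us i        ≈⟨ eq i ⟩
        0#                                                     ∎
  ... | no c≉0 =
    ⊥-elim (v∉W (∈ₛ-resp-≈ᵥ W v≈ (·-∈ₛ W (- y) (lincomb-∈ₛ W us∈W (cs ∘ Fin.suc)))))
    where
      y = proj₁ (inverse _ c≉0)
      v≈ : ((- y) · lincomb (cs ∘ Fin.suc) us) ≈ᵥ v
      v≈ i = c*x+w≈0⇒-y*w≈x (proj₂ (inverse _ c≉0)) (eq i)

  lincomb-coordinate-zero : ∀ {m} cs (vs : Fin m → V) i → (∀ j → vs j i ≈ 0#) → lincomb cs vs i ≈ 0#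
  lincomb-coordinate-zero {zero}  cs vs i _ = ≈-refl
  lincomb-coordinate-zero {suc m} cs vs i vs≈0 =
    trans (+-cong (trans (*-cong ≈-refl (vs≈0 Fin.zero)) (zeroʳ _))
                  (lincomb-coordinate-zero (cs ∘ Fin.suc) (vs ∘ Fin.suc) i (vs≈0 ∘ Fin.suc)))
          (+-identityˡ 0#)

  lincomb-coordinate : ∀ {m} cs (vs : Fin m → V) i j → vs j i ≈ 1# →
                       (∀ j′ → j′ ≢ j → vs j′ i ≈ 0#) → lincomb cs vs i ≈ cs j
  lincomb-coordinate cs vs i Fin.zero vs≈1 vs≈0 =
    trans (+-cong (trans (*-cong ≈-refl vs≈1) (*-identityʳ _))
                  (lincomb-coordinate-zero _ _ i (λ j′ → vs≈0 (Fin.suc j′) λ ())))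
          (+-identityʳ _)
  lincomb-coordinate cs vs i (Fin.suc j) vs≈1 vs≈0 =
    trans (+-cong (trans (*-cong ≈-refl (vs≈0 Fin.zero λ ())) (zeroʳ _))
                  (lincomb-coordinate (cs ∘ Fin.suc) (vs ∘ Fin.suc) i j vs≈1
                    (λ j′ j′≢j → vs≈0 (Fin.suc j′) (j′≢j ∘ suc-injective))))
          (+-identityˡ _)

  unit : Fin n → V
  unit j i with j ≟ᶠ i
  ... | yes _ = 1#
  ... | no  _ = 0#

  unit-same : ∀ j → unit j j ≈ 1#
  unit-same j with j ≟ᶠ j
  ... | yes _   = ≈-refl
  ... | no  j≢j = ⊥-elim (j≢j ≡.refl)

  unit-other : ∀ j i → j ≢ i → unit j i ≈ 0#
  unit-other j i j≢i with j ≟ᶠ i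
  ... | yes j≡i = ⊥-elim (j≢i j≡i)
  ... | no  _   = ≈-refl

  standardSubspace : ∀ {t} → t ≤ n → Subspace t
  standardSubspace t≤n = subspace (λ j → unit (inject≤ j t≤n)) λ cs eq j →
    trans (sym (lincomb-coordinate cs _ (inject≤ j t≤n) j (unit-same (inject≤ j t≤n))
                  (λ j′ j′≢j → unit-other _ _ (j′≢j ∘ inject≤-injective _ _ _ _))))
          (eq _)

  NonTrivial⇒¬¬inhabited : ∀ {k t} {𝓕 : Family k} → t ≤ n → NonTrivial t 𝓕 → ¬ ¬ ∃ (_∈F_ 𝓕)
  NonTrivial⇒¬¬inhabited t≤n nontrivial empty =
    nontrivial (standardSubspace t≤n , λ W W∈𝓕 → ⊥-elim (empty (W , W∈𝓕)))

  RWiseTIntersecting-≤ : ∀ {k r s t} {𝓕 : Family k} → suc s ≤ r →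
                         RWiseTIntersecting r t 𝓕 → RWiseTIntersecting (suc s) t 𝓕
  RWiseTIntersecting-≤ {s = s} s<r intersecting Ws Ws∈𝓕 =
    unfold (intersecting (Ws ∘ fold) (Ws∈𝓕 ∘ fold))
    where
      fold : Fin _ → Fin (suc s)
      fold i = toℕ i mod suc s

      unfold : DimInterGE (Ws ∘ fold) _ → DimInterGE Ws _
      unfold (us , indep , us∈Ws) =
        us , indep , λ j i →
          ≡.subst (λ i → us j ∈ₛ Ws i) (mod-inject≤ i s<r) (us∈Ws j (inject≤ i s<r))

module FiniteField {c ℓ} (F : Field c ℓ) {q} (size : HasSize F q) where
  open Field F renaming (refl to ≈-refl)

  private
    enum : Fin q → Carrier
    enum = proj₁ size

    enum-injective : ∀ i j → enum i ≈ enum j → i ≡ j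
    enum-injective = proj₁ (proj₂ size)

    index : Carrier → Fin q
    index x = proj₁ (proj₂ (proj₂ size) x)

    enum-index : ∀ x → enum (index x) ≈ x
    enum-index x = proj₂ (proj₂ (proj₂ size) x)

    index-injective : ∀ {x y} → index x ≡ index y → x ≈ y
    index-injective {x} {y} eq =
      trans (sym (enum-index x)) (trans (reflexive (≡.cong enum eq)) (enum-index y))

    index-cong : ∀ {x y} → x ≈ y → index x ≡ index y
    index-cong {x} {y} x≈y =
      enum-injective _ _ (trans (enum-index x) (trans x≈y (sym (enum-index y))))

  _≟_ : Decidable _≈_
  x ≟ y = map′ index-injective index-cong (index x ≟ᶠ index y)

  1<q : 1 < q
  1<q = distinct⇒1< (0≉1 ∘ index-injective)

  module _ (n : ℕ) where
    open LinearAlgebra F n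
    open Subspaces F n

    _∈ₛ?_ : ∀ {d} v (W : Subspace d) → Dec (v ∈ₛ W)
    v ∈ₛ? W = map′ (λ (x , p) → enum ∘ finToFun x , p)
                   (λ (cs , p) → funToFin (index ∘ cs) , via-index cs p)
                   (any? λ x → all? λ i → lincomb (enum ∘ finToFun x) basis i ≟ v i)
      where
        open Subspace W using (basis)
        via-index : ∀ cs → lincomb cs basis ≈ᵥ v →
                    lincomb (enum ∘ finToFun (funToFin (index ∘ cs))) basis ≈ᵥ v
        via-index cs p i = trans (lincomb-cong basis round-trip i) (p i)
          where
            round-trip : ∀ j → enum (finToFun (funToFin (index ∘ cs)) j) ≈ cs j
            round-trip j = trans (reflexive (≡.cong enum (finToFun-funToFin _ j))) (enum-index (cs j))

    -- Coordinates in W of the q^m combinations of us determine them, so q^m ≤ q^d.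
    LinIndep-≤ : ∀ {m d} (W : Subspace d) {us : Fin m → V} →
                 LinIndep us → (∀ j → us j ∈ₛ W) → m ≤ d
    LinIndep-≤ {m} {d} W {us} indep us∈W =
      injection⇒exponent-≤ 1<q coordinates coordinates-injective
      where
        open Subspace W using (basis)

        combination∈W : (a : Fin m → Fin q) → lincomb (enum ∘ a) us ∈ₛ W
        combination∈W a = lincomb-∈ₛ W us∈W (enum ∘ a)

        coordinates : (Fin m → Fin q) → Fin d → Fin q
        coordinates a = index ∘ proj₁ (combination∈W a)

        coordinates-injective : ∀ a b → coordinates a ≗ coordinates b → a ≗ b
        coordinates-injective a b eq = enum-injective _ _ ∘ LinIndep-injective indep λ i →
          trans (sym (proj₂ (combination∈W a) i))
                (trans (lincomb-cong basis (index-injective ∘ eq) i) (proj₂ (combination∈W b) i))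

module Intersecting {c ℓ} (F : Field c ℓ) (_≟_ : Decidable (Field._≈_ F)) (n : ℕ)
  (_∈ₛ?_ : ∀ {d} v (W : LinearAlgebra.Subspace F n d) → Dec (LinearAlgebra._∈ₛ_ F n v W))
  {k r t} (𝓕 : LinearAlgebra.Family F n k)
  (intersecting : LinearAlgebra.RWiseTIntersecting F n r t 𝓕)
  (nontrivial : LinearAlgebra.NonTrivial F n t 𝓕) where

  open LinearAlgebra F n
  open Subspaces F n

  ¬¬DimInterGE-+ : ∀ d {s} (Ws : Fin (suc s) → Subspace k) → (∀ i → _∈F_ 𝓕 (Ws i)) →
                   suc s + d ≤ r → ¬ ¬ DimInterGE Ws (d + t)
  ¬¬DimInterGE-+ d {s} Ws Ws∈𝓕 s+d<r
    with RWiseTIntersecting-≤ {𝓕 = 𝓕} (≤-trans (m≤m+n (suc s) d) s+d<r) intersecting Ws Ws∈𝓕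
  ¬¬DimInterGE-+ zero    Ws Ws∈𝓕 s+d<r | common = λ ¬common → ¬common common
  ¬¬DimInterGE-+ (suc d) Ws Ws∈𝓕 s+d<r | us , indep , us∈Ws = λ ¬common →
    nontrivial (subspace us indep , λ W W∈𝓕 v v∈T →
      decidable-stable (v ∈ₛ? W)
        (extend ¬common W W∈𝓕 v λ i → span-⊆ₛ (Ws i) indep (λ j → us∈Ws j i) v v∈T))
    where
      extend : ¬ DimInterGE Ws (suc d + t) →
               ∀ W → _∈F_ 𝓕 W → ∀ v → (∀ i → v ∈ₛ Ws i) → ¬ ¬ (v ∈ₛ W)
      extend ¬common W W∈𝓕 v v∈Ws v∉W =
        ¬¬DimInterGE-+ d (W ∷ Ws) (λ { Fin.zero → W∈𝓕 ; (Fin.suc i) → Ws∈𝓕 i })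
                       (≡.subst (_≤ r) (+-suc (suc _) d) s+d<r)
          λ (us′ , indep′ , us′∈) →
            ¬common (v ∷ us′ , LinIndep-∷ _≟_ W indep′ (λ j → us′∈ j Fin.zero) v∉W ,
                     λ { Fin.zero i → v∈Ws i ; (Fin.suc j) i → us′∈ j (Fin.suc i) })

corollary4p2 : ∀ {c ℓ : Level} (F : Field c ℓ) (q n k t r : ℕ) →
    IsPrimePower q → HasSize F q →
    1 ≤ k → 1 ≤ t → 2 ≤ r → t ≤ n →
    r > k ∸ t + 1 →
    ¬ (∃[ 𝓕 ] (LinearAlgebra.RWiseTIntersecting F n {k} r t 𝓕
    × LinearAlgebra.NonTrivial F n t 𝓕))
corollary4p2 F q n k t r _ size _ _ _ t≤n r>k∸t+1 (𝓕 , intersecting , nontrivial) =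
  NonTrivial⇒¬¬inhabited {𝓕 = 𝓕} t≤n nontrivial λ (W , W∈𝓕) →
    ¬¬DimInterGE-+ (k ∸ t + 1) {0} (λ _ → W) (λ _ → W∈𝓕) r>k∸t+1 λ (us , indep , us∈W) →
      <⇒≱ (m<m∸n+1+n k t) (LinIndep-≤ n W indep λ j → us∈W j Fin.zero)
  where
    open FiniteField F size
    open Subspaces F n
    open Intersecting F _≟_ n (_∈ₛ?_ n) 𝓕 intersecting nontrivial
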